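{- Let $V$ be a finite set. For all partitions $p,q,r\in\Pi(V)$, $$\textsf{acyclic}(p,q)\wedge\textsf{acyclic}(p\sqcup q,r)\iff\textsf{acyclic}(q,r)\wedge\textsf{acyclic}(p,q\sqcup r).$$
   Context: $\Pi(V)$ is the set of partitions of $V$. For $p,q\in\Pi(V)$, $p\sqcup q$ is the join in the refinement lattice (the finest partition coarser than both $p$ and $q$), and $\#p$ is the number of blocks of $p$. The relation $\textsf{acyclic}(p,q)$ holds iff $|V|+\#(p\sqcup q)-(\#p+\#q)=0$. -}

module Defs where

open import Data.Bool using (Bool; true; false; T; not; _∧_; if_then_else_)
open import Data.Nat using (ℕ; _<ᵇ_)
open import Data.Fin using (Fin; toℕ)
open import Data.List using (List; map; allFin)
open import Data.Bool.ListAction using (any)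
open import Data.Nat.ListAction using (sum)
open import Data.Integer using (ℤ; +_; _+_; _-_)
open import Relation.Binary.PropositionalEquality using (_≡_)

-- A partition of the finite set V = Fin n, given as an equivalence
-- relation on Fin n (blocks = equivalence classes), with decidable
-- (Bool-valued) membership "i and j lie in the same block".
record Partition (n : ℕ) : Set where
  field
    same  : Fin n → Fin n → Bool
    refl  : ∀ i → T (same i i)
    sym   : ∀ i j → T (same i j) → T (same j i)
    trans : ∀ i j k → T (same i j) → T (same j k) → T (same i k)
open Partition public

_≼_ : ∀ {n} → Partition n → Partition n → Set
p ≼ q = ∀ i j → T (same p i j) → T (same q i j)

IsJoin : ∀ {n} → Partition n → Partition n → Partition n → Set
IsJoin p q s = p ≼ s × q ≼ s × (∀ t → p ≼ t → q ≼ t → s ≼ t)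
  where open import Data.Product using (_×_)

isRep : ∀ {n} → Partition n → Fin n → Bool
isRep {n} p i = not (any (λ j → (toℕ j <ᵇ toℕ i) ∧ same p j i) (allFin n))

#_ : ∀ {n} → Partition n → ℕ
#_ {n} p = sum (map (λ i → if isRep p i then 1 else 0) (allFin n))

acyclic : ∀ {n} → Partition n → Partition n → (pq : Partition n) → Set
acyclic {n} p q pq = (+ n) + (+ (# pq)) - ((+ (# p)) + (+ (# q))) ≡ + 0

-- Write d(p,q) = |V| + #(p ⊔ q) − #p − #q, so that acyclic(p,q) says d(p,q) = 0.
-- Starting from p and gluing every element to the least element of its q-block
-- reaches p ⊔ q after |V| − #q non-trivial gluings, each losing at most one block;
-- hence d(p,q) ≥ 0.  Both d(p,q) + d(p ⊔ q,r) and d(q,r) + d(p,q ⊔ r) equal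
-- 2|V| + #(p ⊔ q ⊔ r) − #p − #q − #r, and a sum of two non-negative integers
-- vanishes iff both summands do.
module Submission where

open import Defs hiding (refl; sym; trans)
open import Data.Nat using (ℕ)
open import Data.Product using (_×_)
open import Function.Bundles using (_⇔_; mk⇔)

open import Data.Bool using (Bool; true; false; T; not; _∧_; _∨_; if_then_else_)
open import Data.Bool.Properties using (T?; T-∧; T-∨; T-not-≡)
open import Data.Bool.ListAction using (or)
open import Data.Empty using (⊥; ⊥-elim)
open import Data.Fin using (Fin; zero; suc; toℕ; _<_)
open import Data.Fin.Induction using (<-wellFounded)
open import Data.Fin.Properties using (suc-injective; 0≢1+n; <-cmp; <-asym)
open import Data.Integer as ℤ using (ℤ; +_; 0ℤ)
import Data.Integer.Properties as ℤ
open import Data.Integer.Tactic.RingSolver using (solve-∀)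
open import Data.List using (List; []; _∷_; map; tabulate; allFin)
open import Data.List.Membership.Propositional using (_∈_; lose)
open import Data.List.Membership.Propositional.Properties using (∈-allFin)
open import Data.List.Properties using (map-tabulate; map-cong)
open import Data.List.Relation.Unary.Any using (here; there; satisfied)
open import Data.List.Relation.Unary.Any.Properties using (any⁺; any⁻)
open import Data.Nat as ℕ using (_<ᵇ_; _+_; _≤_; z≤n; s≤s)
import Data.Nat.Properties as ℕ
open import Data.Nat.ListAction using (sum)
open import Data.Product using (_,_; proj₁; proj₂; ∃-syntax)
open import Data.Sum as Sum using (_⊎_; inj₁; inj₂)
open import Data.Unit using (tt)
open import Function using (_∘_; id)
open import Function.Bundles using (Equivalence)
open import Induction.WellFounded using (Acc; acc)
open import Relation.Binary.Definitions using (tri<; tri≈; tri>)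
open import Relation.Binary.PropositionalEquality
  using (_≡_; refl; sym; trans; cong; cong₂; subst; subst₂)
open import Relation.Nullary using (¬_; yes; no)

open Partition using () renaming (refl to ~-refl; sym to ~-sym; trans to ~-trans)
open Equivalence using (to; from)

private variable
  n : ℕ

T⇒T⇒≡ : ∀ {x y} → (T x → T y) → (T y → T x) → x ≡ y
T⇒T⇒≡ {false} {false} _ _ = refl
T⇒T⇒≡ {false} {true}  _ g = ⊥-elim (g tt)
T⇒T⇒≡ {true}  {false} f _ = ⊥-elim (f tt)
T⇒T⇒≡ {true}  {true}  _ _ = refl

¬T-not⇒T : ∀ {b} → ¬ T (not b) → T b
¬T-not⇒T {false} ¬nb = ¬nb tt
¬T-not⇒T {true}  _   = tt

indicator : Bool → ℕ
indicator b = if b then 1 else 0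

indicator-not : ∀ {b} → ¬ T b → indicator (not b) ≡ 1
indicator-not {false} _  = refl
indicator-not {true}  ¬b = ⊥-elim (¬b tt)

count : (Fin n → Bool) → ℕ
count u = sum (tabulate (indicator ∘ u))

count-mono : ∀ n {u v : Fin n → Bool} → (∀ i → T (u i) → ¬ T (v i) → ⊥) → count u ≤ count v
count-mono ℕ.zero    _ = z≤n
count-mono (ℕ.suc n) {u} {v} u⊆v with u zero in eu | v zero in ev
... | false | false = count-mono n (u⊆v ∘ suc)
... | false | true  = ℕ.m≤n⇒m≤1+n (count-mono n (u⊆v ∘ suc))
... | true  | true  = s≤s (count-mono n (u⊆v ∘ suc))
... | true  | false = ⊥-elim (u⊆v zero (subst T (sym eu) tt) (subst T ev))

AtMostOneOutside : (u v : Fin n → Bool) → Set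
AtMostOneOutside u v = ∀ {i j} → T (u i) → ¬ T (v i) → T (u j) → ¬ T (v j) → i ≡ j

AtMostOneOutside-tail : ∀ {u v : Fin (ℕ.suc n) → Bool} →
  AtMostOneOutside u v → AtMostOneOutside (u ∘ suc) (v ∘ suc)
AtMostOneOutside-tail unique ui vi uj vj = suc-injective (unique ui vi uj vj)

count-≤-1+ : ∀ n {u v : Fin n → Bool} → AtMostOneOutside u v → count u ≤ 1 + count v
count-≤-1+ ℕ.zero    _ = z≤n
count-≤-1+ (ℕ.suc n) {u} {v} unique with u zero in eu | v zero in ev
... | false | false = count-≤-1+ n (AtMostOneOutside-tail unique)
... | false | true  = ℕ.m≤n⇒m≤1+n (count-≤-1+ n (AtMostOneOutside-tail unique))
... | true  | true  = s≤s (count-≤-1+ n (AtMostOneOutside-tail unique))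
... | true  | false =
  s≤s (count-mono n λ i ui vi → 0≢1+n (unique (subst T (sym eu) tt) (subst T ev) ui vi))

count-not+count : ∀ n (u : Fin n → Bool) → count (not ∘ u) + count u ≡ n
count-not+count ℕ.zero    u = refl
count-not+count (ℕ.suc n) u with u zero
... | false = cong ℕ.suc (count-not+count n (u ∘ suc))
... | true  = trans (ℕ.+-suc (count (not ∘ u ∘ suc)) _) (cong ℕ.suc (count-not+count n (u ∘ suc)))

module _ (p : Partition n) where

  precedes : Fin n → Fin n → Bool
  precedes i j = (toℕ j <ᵇ toℕ i) ∧ same p j i

  isRep-minimal : ∀ {i j} → T (isRep p i) → j < i → ¬ T (same p j i)
  isRep-minimal rep j<i j~i =
    subst T (to T-not-≡ rep) (any⁺ (precedes _) (lose (∈-allFin _) (from T-∧ (ℕ.<⇒<ᵇ j<i , j~i))))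

  ¬isRep⇒preceded : ∀ {i} → ¬ T (isRep p i) → ∃[ j ] j < i × T (same p j i)
  ¬isRep⇒preceded {i} ¬rep with satisfied (any⁻ (precedes i) (allFin n) (¬T-not⇒T ¬rep))
  ... | j , j<i∧j~i = j , ℕ.<ᵇ⇒< _ _ (proj₁ (to T-∧ j<i∧j~i)) , proj₂ (to T-∧ j<i∧j~i)

  isRep-unique : ∀ {i j} → T (isRep p i) → T (isRep p j) → T (same p i j) → i ≡ j
  isRep-unique {i} {j} rep-i rep-j i~j with <-cmp i j
  ... | tri< i<j _ _ = ⊥-elim (isRep-minimal rep-j i<j i~j)
  ... | tri≈ _ i≡j _ = i≡j
  ... | tri> _ _ j<i = ⊥-elim (isRep-minimal rep-i j<i (~-sym p i j i~j))

  rep-exists : ∀ i → ∃[ r ] T (isRep p r) × T (same p r i)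
  rep-exists i = go i (<-wellFounded i)
    where
      go : ∀ i → Acc _<_ i → ∃[ r ] T (isRep p r) × T (same p r i)
      go i (acc below) with isRep p i in e
      ... | true  = i , subst T (sym e) tt , ~-refl p i
      ... | false with ¬isRep⇒preceded (subst T e)
      ...   | j , j<i , j~i with go j (below j<i)
      ...     | r , rep , r~j = r , rep , ~-trans p r j i r~j j~i

≼-refl : (p : Partition n) → p ≼ p
≼-refl _ _ _ i~j = i~j

≼-trans : (p q r : Partition n) → p ≼ q → q ≼ r → p ≼ r
≼-trans _ _ _ p≼q q≼r i j i~j = q≼r i j (p≼q i j i~j)

#≡count : (p : Partition n) → # p ≡ count (isRep p)
#≡count p = cong sum (map-tabulate id (indicator ∘ isRep p))

#-cong : (p q : Partition n) → p ≼ q → q ≼ p → # p ≡ # q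
#-cong {n} p q p≼q q≼p = cong sum (map-cong (cong indicator ∘ isRep-cong) (allFin n))
  where
    isRep-cong : ∀ i → isRep p i ≡ isRep q i
    isRep-cong i = cong (not ∘ or) (map-cong
      (λ j → cong ((toℕ j <ᵇ toℕ i) ∧_) (T⇒T⇒≡ (p≼q j i) (q≼p j i))) (allFin n))

IsJoin-#-unique : (p q s s′ : Partition n) → IsJoin p q s → IsJoin p q s′ → # s ≡ # s′
IsJoin-#-unique p q s s′ (p≼s , q≼s , s-least) (p≼s′ , q≼s′ , s′-least) =
  #-cong s s′ (s-least s′ p≼s′ q≼s′) (s′-least s p≼s q≼s)

IsJoin-assoc : (p q r pq qr s : Partition n) →
  IsJoin p q pq → IsJoin q r qr → IsJoin pq r s → IsJoin p qr s
IsJoin-assoc p q r pq qr s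
  (p≼pq , q≼pq , pq-least) (q≼qr , r≼qr , qr-least) (pq≼s , r≼s , s-least) =
  ≼-trans p pq s p≼pq pq≼s ,
  qr-least s (≼-trans q pq s q≼pq pq≼s) r≼s ,
  λ t p≼t qr≼t →
    s-least t (pq-least t p≼t (≼-trans q qr t q≼qr qr≼t)) (≼-trans r qr t r≼qr qr≼t)

module _ (t : Partition n) (a b : Fin n) where

  glued : Fin n → Bool
  glued i = same t a i ∨ same t b i

  private
    linked : ∀ {x i j} → T (same t x i) → T (same t x j) → T (same t i j)
    linked {x} {i} {j} x~i x~j = ~-trans t i x j (~-sym t x i x~i) x~j

    glued-resp : ∀ {i j} → T (same t i j) → T (glued i) → T (glued j)
    glued-resp {i} {j} i~j gi with to T-∨ gi
    ... | inj₁ a~i = from T-∨ (inj₁ (~-trans t a i j a~i i~j))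
    ... | inj₂ b~i = from T-∨ (inj₂ (~-trans t b i j b~i i~j))

  mergedSame : Fin n → Fin n → Bool
  mergedSame i j = same t i j ∨ (glued i ∧ glued j)

  private
    merged⁻ : ∀ {i j} → T (mergedSame i j) → T (same t i j) ⊎ (T (glued i) × T (glued j))
    merged⁻ = Sum.map₂ (to T-∧) ∘ to T-∨

    mergedˡ : ∀ {i j} → T (same t i j) → T (mergedSame i j)
    mergedˡ = from T-∨ ∘ inj₁

    mergedʳ : ∀ {i j} → T (glued i) → T (glued j) → T (mergedSame i j)
    mergedʳ gi gj = from T-∨ (inj₂ (from T-∧ (gi , gj)))

    merged-sym : ∀ i j → T (mergedSame i j) → T (mergedSame j i)
    merged-sym i j i~j with merged⁻ i~j
    ... | inj₁ i~j      = mergedˡ (~-sym t i j i~j)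
    ... | inj₂ (gi , gj) = mergedʳ gj gi

    merged-trans : ∀ i j k → T (mergedSame i j) → T (mergedSame j k) → T (mergedSame i k)
    merged-trans i j k i~j j~k with merged⁻ i~j | merged⁻ j~k
    ... | inj₁ i~j       | inj₁ j~k       = mergedˡ (~-trans t i j k i~j j~k)
    ... | inj₁ i~j       | inj₂ (gj , gk) = mergedʳ (glued-resp (~-sym t i j i~j) gj) gk
    ... | inj₂ (gi , gj) | inj₁ j~k       = mergedʳ gi (glued-resp j~k gj)
    ... | inj₂ (gi , _)  | inj₂ (_ , gk)  = mergedʳ gi gk

  merge : Partition n
  merge = record
    { same  = mergedSame
    ; refl  = λ i → mergedˡ (~-refl t i)
    ; sym   = merged-sym
    ; trans = merged-trans
    }

  ≼-merge : t ≼ merge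
  ≼-merge _ _ = mergedˡ

  merge-glues : T (same merge a b)
  merge-glues = mergedʳ (from T-∨ (inj₁ (~-refl t a))) (from T-∨ (inj₂ (~-refl t b)))

  merge-least : (s : Partition n) → t ≼ s → T (same s a b) → merge ≼ s
  merge-least s t≼s a~b i j i~j with merged⁻ i~j
  ... | inj₁ i~j       = t≼s i j i~j
  ... | inj₂ (gi , gj) = ~-trans s i a j (~-sym s a i (a~ gi)) (a~ gj)
    where
      a~ : ∀ {k} → T (glued k) → T (same s a k)
      a~ {k} gk with to T-∨ gk
      ... | inj₁ a~k = t≼s a k a~k
      ... | inj₂ b~k = ~-trans s a b k a~b (t≼s b k b~k)

  #-merge-trivial : T (same t a b) → # merge ≡ # t
  #-merge-trivial a~b = #-cong merge t (merge-least t (≼-refl t) a~b) ≼-merge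

  private
    lost-rep : ∀ {i} → T (isRep t i) → ¬ T (isRep merge i) →
               ∃[ j ] j < i × T (glued j) × T (glued i) × ¬ T (same t j i)
    lost-rep rep ¬rep′ with ¬isRep⇒preceded merge ¬rep′
    ... | j , j<i , j~i with merged⁻ j~i
    ...   | inj₁ j~i       = ⊥-elim (isRep-minimal t rep j<i j~i)
    ...   | inj₂ (gj , gi) = j , j<i , gj , gi , isRep-minimal t rep j<i

    glued-other : ∀ {i i′ j} → T (glued i) → T (glued i′) → ¬ T (same t i i′) →
                  T (glued j) → ¬ T (same t j i) → T (same t j i′)
    glued-other gi gi′ i≁i′ gj j≁i with to T-∨ gi | to T-∨ gi′ | to T-∨ gj
    ... | inj₁ a~i | inj₁ a~i′ | _        = ⊥-elim (i≁i′ (linked a~i a~i′))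
    ... | inj₂ b~i | inj₂ b~i′ | _        = ⊥-elim (i≁i′ (linked b~i b~i′))
    ... | inj₁ a~i | inj₂ _    | inj₁ a~j = ⊥-elim (j≁i (linked a~j a~i))
    ... | inj₁ _   | inj₂ b~i′ | inj₂ b~j = linked b~j b~i′
    ... | inj₂ _   | inj₁ a~i′ | inj₁ a~j = linked a~j a~i′
    ... | inj₂ b~i | inj₁ _    | inj₂ b~j = ⊥-elim (j≁i (linked b~j b~i))

    -- Only the larger of the minima of the two glued blocks stops being a representative.
    lost-rep-unique : AtMostOneOutside (isRep t) (isRep merge)
    lost-rep-unique {i} {i′} rep ¬rep′ rep′ ¬rep′′ with T? (same t i i′)
    ... | yes i~i′ = isRep-unique t rep rep′ i~i′
    ... | no  i≁i′ with lost-rep rep ¬rep′ | lost-rep rep′ ¬rep′′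
    ...   | j , j<i , gj , gi , j≁i | j′ , j′<i′ , gj′ , gi′ , j′≁i′ =
      ⊥-elim (<-asym i′<i i<i′)
      where
        i′<i : i′ < i
        i′<i = ℕ.≤-<-trans (ℕ.≮⇒≥ (λ j<i′ → isRep-minimal t rep′ j<i′
                 (glued-other gi gi′ i≁i′ gj j≁i))) j<i
        i<i′ : i < i′
        i<i′ = ℕ.≤-<-trans (ℕ.≮⇒≥ (λ j′<i → isRep-minimal t rep j′<i
                 (glued-other gi′ gi (i≁i′ ∘ ~-sym t i′ i) gj′ j′≁i′))) j′<i′

  #-merge : # t ≤ 1 + # merge
  #-merge = subst₂ (λ x y → x ≤ 1 + y) (sym (#≡count t)) (sym (#≡count merge))
                   (count-≤-1+ n lost-rep-unique)

module _ (p q : Partition n) where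

  private
    rep : Fin n → Fin n
    rep k = proj₁ (rep-exists q k)

    rep-isRep : ∀ k → T (isRep q (rep k))
    rep-isRep k = proj₁ (proj₂ (rep-exists q k))

    rep-~ : ∀ k → T (same q (rep k) k)
    rep-~ k = proj₂ (proj₂ (rep-exists q k))

    rep-of-rep : ∀ {k} → T (isRep q k) → rep k ≡ k
    rep-of-rep {k} r = isRep-unique q (rep-isRep k) r (rep-~ k)

    rep-cong : ∀ {i j} → T (same q i j) → rep i ≡ rep j
    rep-cong {i} {j} i~j = isRep-unique q (rep-isRep i) (rep-isRep j)
      (~-trans q (rep i) i (rep j) (rep-~ i)
        (~-trans q i j (rep j) i~j (~-sym q (rep j) j (rep-~ j))))

  glueAll : List (Fin n) → Partition n
  glueAll []       = p
  glueAll (k ∷ ks) = merge (glueAll ks) k (rep k)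

  ≼-glueAll : ∀ ks → p ≼ glueAll ks
  ≼-glueAll []       = ≼-refl p
  ≼-glueAll (k ∷ ks) =
    ≼-trans p (glueAll ks) (glueAll (k ∷ ks)) (≼-glueAll ks) (≼-merge (glueAll ks) k (rep k))

  glueAll-glues : ∀ {k ks} → k ∈ ks → T (same (glueAll ks) k (rep k))
  glueAll-glues {ks = k ∷ ks}  (here refl) = merge-glues (glueAll ks) k (rep k)
  glueAll-glues {ks = k′ ∷ ks} (there k∈ks) =
    ≼-merge (glueAll ks) k′ (rep k′) _ _ (glueAll-glues k∈ks)

  glueAll-least : ∀ s → p ≼ s → q ≼ s → ∀ ks → glueAll ks ≼ s
  glueAll-least s p≼s q≼s []       = p≼s
  glueAll-least s p≼s q≼s (k ∷ ks) =
    merge-least (glueAll ks) k (rep k) s (glueAll-least s p≼s q≼s ks)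
      (~-sym s (rep k) k (q≼s (rep k) k (rep-~ k)))

  glueAll-isJoin : IsJoin p q (glueAll (allFin n))
  glueAll-isJoin = ≼-glueAll (allFin n) , q≼glued , λ s p≼s q≼s → glueAll-least s p≼s q≼s (allFin n)
    where
      J = glueAll (allFin n)
      k~rep : ∀ k → T (same J k (rep k))
      k~rep k = glueAll-glues (∈-allFin k)
      q≼glued : q ≼ J
      q≼glued i j i~j = ~-trans J i (rep i) j (k~rep i)
        (subst (λ r → T (same J r j)) (sym (rep-cong i~j)) (~-sym J j (rep j) (k~rep j)))

  private
    nonReps : List (Fin n) → ℕ
    nonReps ks = sum (map (indicator ∘ not ∘ isRep q) ks)

    #-glue : ∀ t k → # t ≤ indicator (not (isRep q k)) + # (merge t k (rep k))
    #-glue t k with T? (isRep q k)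
    ... | yes r = ℕ.≤-trans (ℕ.≤-reflexive (sym (#-merge-trivial t k (rep k) k~rep))) (ℕ.m≤n+m _ _)
      where
        k~rep : T (same t k (rep k))
        k~rep = subst (T ∘ same t k) (sym (rep-of-rep r)) (~-refl t k)
    ... | no ¬r =
      subst (λ w → # t ≤ w + # (merge t k (rep k))) (sym (indicator-not ¬r)) (#-merge t k (rep k))

  #-glueAll : ∀ ks → # p ≤ # (glueAll ks) + nonReps ks
  #-glueAll []       = ℕ.≤-reflexive (sym (ℕ.+-identityʳ (# p)))
  #-glueAll (k ∷ ks) = begin
    # p                                     ≤⟨ #-glueAll ks ⟩
    # G + nonReps ks                        ≤⟨ ℕ.+-monoˡ-≤ (nonReps ks) (#-glue G k) ⟩
    (w + # (glueAll (k ∷ ks))) + nonReps ks ≡⟨ cong (_+ nonReps ks) (ℕ.+-comm w _) ⟩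
    (# (glueAll (k ∷ ks)) + w) + nonReps ks ≡⟨ ℕ.+-assoc (# (glueAll (k ∷ ks))) w (nonReps ks) ⟩
    # (glueAll (k ∷ ks)) + nonReps (k ∷ ks) ∎
    where
      open ℕ.≤-Reasoning
      G = glueAll ks
      w = indicator (not (isRep q k))

  #-IsJoin-≤ : ∀ s → IsJoin p q s → # p + # q ≤ n + # s
  #-IsJoin-≤ s s-join = begin
    # p + # q                      ≤⟨ ℕ.+-monoˡ-≤ (# q) (#-glueAll (allFin n)) ⟩
    (# J + nonReps (allFin n)) + # q ≡⟨ ℕ.+-assoc (# J) _ (# q) ⟩
    # J + (nonReps (allFin n) + # q) ≡⟨ cong (_+_ (# J)) nonReps+#≡n ⟩
    # J + n                        ≡⟨ ℕ.+-comm (# J) n ⟩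
    n + # J                        ≡⟨ cong (_+_ n) (IsJoin-#-unique p q J s glueAll-isJoin s-join) ⟩
    n + # s                        ∎
    where
      open ℕ.≤-Reasoning
      J = glueAll (allFin n)
      nonReps+#≡n : nonReps (allFin n) + # q ≡ n
      nonReps+#≡n = trans
        (cong₂ _+_ (cong sum (map-tabulate id (indicator ∘ not ∘ isRep q))) (#≡count q))
        (count-not+count n (isRep q))

defect : (p q pq : Partition n) → ℤ
defect {n} p q pq = + n ℤ.+ + # pq ℤ.- (+ # p ℤ.+ + # q)

defect-nonneg : (p q s : Partition n) → IsJoin p q s → 0ℤ ℤ.≤ defect p q s
defect-nonneg p q s s-join = ℤ.i≤j⇒0≤j-i (ℤ.+≤+ (#-IsJoin-≤ p q s s-join))

exchange-identity : ∀ (n a b c x y z : ℤ) →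
  (n ℤ.+ x ℤ.- (a ℤ.+ b)) ℤ.+ (n ℤ.+ z ℤ.- (x ℤ.+ c)) ≡
  (n ℤ.+ y ℤ.- (b ℤ.+ c)) ℤ.+ (n ℤ.+ z ℤ.- (a ℤ.+ y))
exchange-identity = solve-∀

defect-exchange : (p q r pq qr s s′ : Partition n) → # s ≡ # s′ →
  defect p q pq ℤ.+ defect pq r s ≡ defect q r qr ℤ.+ defect p qr s′
defect-exchange {n} p q r pq qr s s′ #s≡#s′ =
  trans (exchange-identity (+ n) (+ # p) (+ # q) (+ # r) (+ # pq) (+ # qr) (+ # s))
        (cong (λ z → defect q r qr ℤ.+ (+ n ℤ.+ + z ℤ.- (+ # p ℤ.+ + # qr))) #s≡#s′)

nonneg-+-≡0 : ∀ {i j} → 0ℤ ℤ.≤ i → 0ℤ ℤ.≤ j → i ℤ.+ j ≡ 0ℤ → i ≡ 0ℤ × j ≡ 0ℤ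
nonneg-+-≡0 {+ m} {+ k} _ _ m+k≡0 =
  cong +_ (ℕ.m+n≡0⇒m≡0 m (ℤ.+-injective m+k≡0)) , cong +_ (ℕ.m+n≡0⇒n≡0 m (ℤ.+-injective m+k≡0))

fact3p2 : (n : ℕ) (p q r : Partition n)
    → (pq : Partition n) → IsJoin p q pq
    → (qr : Partition n) → IsJoin q r qr
    → (pq-r : Partition n) → IsJoin pq r pq-r
    → (p-qr : Partition n) → IsJoin p qr p-qr
    → (acyclic p q pq × acyclic pq r pq-r) ⇔ (acyclic q r qr × acyclic p qr p-qr)
fact3p2 n p q r pq pq-join qr qr-join pq-r pq-r-join p-qr p-qr-join = mk⇔
  (λ (d₁ , d₂) → nonneg-+-≡0 d₃≥0 d₄≥0 (trans (sym exchange) (cong₂ ℤ._+_ d₁ d₂)))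
  (λ (d₃ , d₄) → nonneg-+-≡0 d₁≥0 d₂≥0 (trans exchange (cong₂ ℤ._+_ d₃ d₄)))
  where
    exchange : defect p q pq ℤ.+ defect pq r pq-r ≡ defect q r qr ℤ.+ defect p qr p-qr
    exchange = defect-exchange p q r pq qr pq-r p-qr (IsJoin-#-unique p qr pq-r p-qr
      (IsJoin-assoc p q r pq qr pq-r pq-join qr-join pq-r-join) p-qr-join)

    d₁≥0 = defect-nonneg p q pq pq-join
    d₂≥0 = defect-nonneg pq r pq-r pq-r-join
    d₃≥0 = defect-nonneg q r qr qr-join
    d₄≥0 = defect-nonneg p qr p-qr p-qr-join
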